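{- The vector $(1,1,1,1,1)^T\in\mathbb{Z}[i]^5$, whose norm $5=2^2+1^2$ is a sum of two rational squares, cannot be extended to a $5$-icube in $\mathbb{Z}[i]^5$.
   Context: For a complex vector or matrix $M$, $M^*=\overline{M}^T$. For $1\le k\le n$, a matrix $(v_1|\dots|v_k)\in\mathbb{Z}[i]^{n\times k}$ is a $k$-icube of norm $\lambda>0$ if $v_i^*v_j=\lambda$ for $i=j$ and $0$ for $i\neq j$; a vector is extended to an $n$-icube if it is a column of some $n$-icube. It is known that if $n$ is odd and a vector in $\mathbb{Z}[i]^n$ lies in an $n$-icube of norm $\lambda$, then $\lambda$ is a sum of two rational squares; this example shows the converse fails. -}

module Defs where

open import Data.Nat using (ℕ; zero; suc)
open import Data.Integer using (ℤ; +_; 0ℤ; 1ℤ; _<_) renaming (_+_ to _+ℤ_; _*_ to _*ℤ_; -_ to -ℤ_)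
open import Data.Fin using (Fin; zero; suc)
open import Data.Product using (_×_; _,_; proj₁; proj₂; Σ; ∃)
open import Relation.Binary.PropositionalEquality using (_≡_; _≢_)

-- Gaussian integers ℤ[i], represented as a + b i with (a , b) : ℤ × ℤ
ℤ[i] : Set
ℤ[i] = ℤ × ℤ

re im : ℤ[i] → ℤ
re = proj₁
im = proj₂

0ᵍ : ℤ[i]
0ᵍ = 0ℤ , 0ℤ

1ᵍ : ℤ[i]
1ᵍ = 1ℤ , 0ℤ

ιℤ : ℤ → ℤ[i]
ιℤ a = a , 0ℤ

_+ᵍ_ : ℤ[i] → ℤ[i] → ℤ[i]
(a , b) +ᵍ (c , d) = (a +ℤ c) , (b +ℤ d)

_*ᵍ_ : ℤ[i] → ℤ[i] → ℤ[i]
(a , b) *ᵍ (c , d) = ((a *ℤ c) +ℤ (-ℤ (b *ℤ d))) , ((a *ℤ d) +ℤ (b *ℤ c))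

conj : ℤ[i] → ℤ[i]
conj (a , b) = a , (-ℤ b)

Σᵍ : (n : ℕ) → (Fin n → ℤ[i]) → ℤ[i]
Σᵍ zero    f = 0ᵍ
Σᵍ (suc n) f = f zero +ᵍ Σᵍ n (λ k → f (suc k))

Vecᵍ : ℕ → Set
Vecᵍ n = Fin n → ℤ[i]

_⋆_ : {n : ℕ} → Vecᵍ n → Vecᵍ n → ℤ[i]
_⋆_ {n} v w = Σᵍ n (λ k → conj (v k) *ᵍ w k)

-- n × k matrices over ℤ[i], given by entries M r c (row r, column c)
Matᵍ : ℕ → ℕ → Set
Matᵍ n k = Fin n → Fin k → ℤ[i]

column : {n k : ℕ} → Matᵍ n k → Fin k → Vecᵍ n
column M c r = M r c

-- M is a k-icube of norm λ (λ a positive integer, as λ > 0 real and λ = v*v ∈ ℤ[i])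
IsIcube : (n k : ℕ) → Matᵍ n k → ℤ → Set
IsIcube n k M λ' =
  (0ℤ < λ') ×
  ((i : Fin k) → column M i ⋆ column M i ≡ ιℤ λ') ×
  ((i j : Fin k) → i ≢ j → column M i ⋆ column M j ≡ 0ᵍ)

ExtendsToIcube : (n : ℕ) → Vecᵍ n → Set
ExtendsToIcube n v =
  Σ (Matᵍ n n) λ M → Σ ℤ λ λ' → IsIcube n n M λ' × Σ (Fin n) λ c → ((r : Fin n) → column M c r ≡ v r)

{-# OPTIONS --safe #-}
-- Reduce modulo the prime 1 + i, whose residue field is 𝔽₂. There conjugation is trivial
-- and p² = p, so v ⋆ w reduces to Σₖ vₖ wₖ and w ⋆ w to Σₖ wₖ. If every vₖ is 1 modulo 1 + i,
-- as for v = (1,…,1), and w is another column of an icube containing v, then w ⋆ w reduces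
-- like v ⋆ w = 0, whereas w ⋆ w = v ⋆ v reduces to the dimension n; so n cannot be odd.
module Submission where

open import Defs
open import Relation.Nullary using (¬_)
open import Data.Nat as ℕ using (zero; suc; parity)
open import Data.Nat.Properties using (+-suc)
open import Data.Integer as ℤ using (ℤ; +_; -[1+_]; _⊖_; ∣_∣)
open import Data.Integer.Properties using ([1+m]⊖[1+n]≡m⊖n; abs-*; ∣-i∣≡∣i∣)
open import Data.Parity.Base using (Parity; 0ℙ; 1ℙ; _+_; _*_)
open import Data.Parity.Properties
  using (_≟_; +-comm; +-identityʳ; *-idem; *-identityˡ; +-homo-+; *-homo-*;
         +-*-commutativeRing; +-commutativeSemigroup; +-0-monoid)
open import Algebra.Properties.CommutativeSemigroup +-commutativeSemigroup using (interchange)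
open import Algebra.Properties.Monoid.Sum +-0-monoid using (sum; sum-cong-≗)
import Algebra.Solver.Ring.Simple as Solver
import Algebra.Solver.Ring.AlmostCommutativeRing as ACR
open import Data.Fin using (zero; suc; punchIn)
open import Data.Fin.Properties using (punchInᵢ≢i)
open import Data.Vec.Functional using (replicate)
open import Data.Product using (_,_)
open import Function using (_∘_)
open import Relation.Binary.PropositionalEquality
open ≡-Reasoning

open Solver (ACR.fromCommutativeRing +-*-commutativeRing) _≟_ using (solve; _:+_; _:*_; _:=_)

parityℤ : ℤ → Parity
parityℤ = parity ∘ ∣_∣

parity-suc+suc : ∀ m n → parity (suc m) + parity (suc n) ≡ parity m + parity n
parity-suc+suc m n = begin
  parity (suc m) + parity (suc n) ≡⟨ +-homo-+ (suc m) (suc n) ⟨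
  parity (suc (m ℕ.+ suc n))      ≡⟨ cong (parity ∘ suc) (+-suc m n) ⟩
  parity (m ℕ.+ n)                ≡⟨ +-homo-+ m n ⟩
  parity m + parity n             ∎

parityℤ-⊖ : ∀ m n → parityℤ (m ⊖ n) ≡ parity m + parity n
parityℤ-⊖ zero    zero    = refl
parityℤ-⊖ (suc m) zero    = sym (+-identityʳ (parity (suc m)))
parityℤ-⊖ zero    (suc n) = refl
parityℤ-⊖ (suc m) (suc n) = begin
  parityℤ (suc m ⊖ suc n)         ≡⟨ cong parityℤ ([1+m]⊖[1+n]≡m⊖n m n) ⟩
  parityℤ (m ⊖ n)                 ≡⟨ parityℤ-⊖ m n ⟩
  parity m + parity n             ≡⟨ parity-suc+suc m n ⟨
  parity (suc m) + parity (suc n) ∎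

parityℤ-homo-+ : ∀ x y → parityℤ (x ℤ.+ y) ≡ parityℤ x + parityℤ y
parityℤ-homo-+ (+ m)    (+ n)    = +-homo-+ m n
parityℤ-homo-+ (+ m)    -[1+ n ] = parityℤ-⊖ m (suc n)
parityℤ-homo-+ -[1+ m ] (+ n)    = trans (parityℤ-⊖ n (suc m)) (+-comm (parity n) (parity (suc m)))
parityℤ-homo-+ -[1+ m ] -[1+ n ] = trans (+-homo-+ m n) (sym (parity-suc+suc m n))

parityℤ-homo-* : ∀ x y → parityℤ (x ℤ.* y) ≡ parityℤ x * parityℤ y
parityℤ-homo-* x y = trans (cong parity (abs-* x y)) (*-homo-* ∣ x ∣ ∣ y ∣)

parityℤ-neg : ∀ x → parityℤ (ℤ.- x) ≡ parityℤ x
parityℤ-neg x = cong parity (∣-i∣≡∣i∣ x)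

-- Reduction modulo 1 + i, using i ≡ 1 there.
parityᵍ : ℤ[i] → Parity
parityᵍ (a , b) = parityℤ a + parityℤ b

parityᵍ-homo-+ : ∀ z w → parityᵍ (z +ᵍ w) ≡ parityᵍ z + parityᵍ w
parityᵍ-homo-+ (a , b) (c , d) = begin
  parityℤ (a ℤ.+ c) + parityℤ (b ℤ.+ d)                   ≡⟨ cong₂ _+_ (parityℤ-homo-+ a c) (parityℤ-homo-+ b d) ⟩
  (parityℤ a + parityℤ c) + (parityℤ b + parityℤ d)       ≡⟨ interchange (parityℤ a) (parityℤ c) (parityℤ b) (parityℤ d) ⟩
  (parityℤ a + parityℤ b) + (parityℤ c + parityℤ d)       ∎

parityᵍ-homo-* : ∀ z w → parityᵍ (z *ᵍ w) ≡ parityᵍ z * parityᵍ w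
parityᵍ-homo-* (a , b) (c , d) = begin
  parityℤ (a ℤ.* c ℤ.+ ℤ.- (b ℤ.* d)) + parityℤ (a ℤ.* d ℤ.+ b ℤ.* c)
    ≡⟨ cong₂ _+_ (trans (parityℤ-homo-+ (a ℤ.* c) _) (cong₂ _+_ (parityℤ-homo-* a c) real-part))
                 (trans (parityℤ-homo-+ (a ℤ.* d) _) (cong₂ _+_ (parityℤ-homo-* a d) (parityℤ-homo-* b c))) ⟩
  ((pa * pc) + (pb * pd)) + ((pa * pd) + (pb * pc))
    ≡⟨ solve 4 (λ a b c d → (a :* c :+ b :* d) :+ (a :* d :+ b :* c) := (a :+ b) :* (c :+ d))
             refl pa pb pc pd ⟩
  (pa + pb) * (pc + pd) ∎
  where
  pa = parityℤ a
  pb = parityℤ b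
  pc = parityℤ c
  pd = parityℤ d
  real-part : parityℤ (ℤ.- (b ℤ.* d)) ≡ pb * pd
  real-part = trans (parityℤ-neg (b ℤ.* d)) (parityℤ-homo-* b d)

parityᵍ-conj : ∀ z → parityᵍ (conj z) ≡ parityᵍ z
parityᵍ-conj (a , b) = cong (_+_ (parityℤ a)) (parityℤ-neg b)

parityᵍ-homo-Σ : ∀ n (f : Vecᵍ n) → parityᵍ (Σᵍ n f) ≡ sum (parityᵍ ∘ f)
parityᵍ-homo-Σ zero    f = refl
parityᵍ-homo-Σ (suc n) f =
  trans (parityᵍ-homo-+ (f zero) _) (cong (_+_ (parityᵍ (f zero))) (parityᵍ-homo-Σ n (f ∘ suc)))

parityᵍ-⋆ : ∀ {n} (v w : Vecᵍ n) → parityᵍ (v ⋆ w) ≡ sum (λ k → parityᵍ (v k) * parityᵍ (w k))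
parityᵍ-⋆ {n} v w = trans (parityᵍ-homo-Σ n _) (sum-cong-≗ λ k →
  trans (parityᵍ-homo-* (conj (v k)) (w k)) (cong (_* parityᵍ (w k)) (parityᵍ-conj (v k))))

parityᵍ-⋆-self : ∀ {n} (w : Vecᵍ n) → parityᵍ (w ⋆ w) ≡ sum (parityᵍ ∘ w)
parityᵍ-⋆-self w = trans (parityᵍ-⋆ w w) (sum-cong-≗ (*-idem ∘ parityᵍ ∘ w))

OddEntries : ∀ {n} → Vecᵍ n → Set
OddEntries v = ∀ k → parityᵍ (v k) ≡ 1ℙ

parityᵍ-⋆-oddˡ : ∀ {n} (u : Vecᵍ n) → OddEntries u → ∀ w → parityᵍ (u ⋆ w) ≡ sum (parityᵍ ∘ w)
parityᵍ-⋆-oddˡ u odd w = trans (parityᵍ-⋆ u w) (sum-cong-≗ λ k →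
  trans (cong (_* parityᵍ (w k)) (odd k)) (*-identityˡ (parityᵍ (w k))))

sum-replicate-1ℙ : ∀ n → sum (replicate n 1ℙ) ≡ parity n
sum-replicate-1ℙ zero    = refl
sum-replicate-1ℙ (suc n) = trans (cong (_+_ 1ℙ) (sum-replicate-1ℙ n)) (sym (+-homo-+ 1 n))

parityᵍ-norm-odd : ∀ {n} (u : Vecᵍ n) → OddEntries u → parityᵍ (u ⋆ u) ≡ parity n
parityᵍ-norm-odd {n} u odd = begin
  parityᵍ (u ⋆ u)          ≡⟨ parityᵍ-⋆-oddˡ u odd u ⟩
  sum (parityᵍ ∘ u)        ≡⟨ sum-cong-≗ odd ⟩
  sum (replicate n 1ℙ)     ≡⟨ sum-replicate-1ℙ n ⟩
  parity n                 ∎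

orthogonal-to-odd-⇒-norm≢ : ∀ {n} (u w : Vecᵍ n) → parity n ≡ 1ℙ → OddEntries u →
                            u ⋆ w ≡ 0ᵍ → w ⋆ w ≢ u ⋆ u
orthogonal-to-odd-⇒-norm≢ {n} u w n-odd u-odd u⊥w equal-norms = 0ℙ≢1ℙ (begin
  0ℙ                   ≡⟨ cong parityᵍ u⊥w ⟨
  parityᵍ (u ⋆ w)      ≡⟨ parityᵍ-⋆-oddˡ u u-odd w ⟩
  sum (parityᵍ ∘ w)    ≡⟨ parityᵍ-⋆-self w ⟨
  parityᵍ (w ⋆ w)      ≡⟨ cong parityᵍ equal-norms ⟩
  parityᵍ (u ⋆ u)      ≡⟨ parityᵍ-norm-odd u u-odd ⟩
  parity n             ≡⟨ n-odd ⟩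
  1ℙ                   ∎)
  where
  0ℙ≢1ℙ : 0ℙ ≢ 1ℙ
  0ℙ≢1ℙ ()

oddEntries-not-extendable : ∀ {m} {v : Vecᵍ (suc (suc m))} → parity (suc (suc m)) ≡ 1ℙ →
                            OddEntries v → ¬ ExtendsToIcube (suc (suc m)) v
oddEntries-not-extendable n-odd v-odd (M , _ , (_ , norm , orth) , c , col-c≡v) =
  orthogonal-to-odd-⇒-norm≢ (column M c) (column M c′) n-odd col-c-odd
    (orth c c′ (≢-sym (punchInᵢ≢i c zero)))
    (trans (norm c′) (sym (norm c)))
  where
  c′ = punchIn c zero
  col-c-odd : OddEntries (column M c)
  col-c-odd k = trans (cong parityᵍ (col-c≡v k)) (v-odd k)

mainTheorem10 : ¬ ExtendsToIcube 5 (λ _ → 1ᵍ)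
mainTheorem10 = oddEntries-not-extendable refl (λ _ → refl)
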